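{- Let $M=M[U,L]$ be a lattice path matroid on $n$ elements and let $k\in\mathbb{N}$. Then a point $p\in\mathbb{R}^n$ lies in $kP_M\cap\mathbb{Z}^n$ if and only if $p=k\,\mathrm{st}(P)$ for some generalized lattice path $P$ of $M$ all of whose bend points $(x,y)$ satisfy $kx,ky\in\mathbb{Z}$.
   Context: A lattice path from $(0,0)$ to $(m,r)$ (with $n=r+m$) is a path using unit steps $(1,0)$ and $(0,1)$; its step vector lists the $y$-coordinate changes of its steps. For lattice paths $U,L$ from $(0,0)$ to $(m,r)$ with $L$ never above $U$, $M[U,L]$ is the matroid on $\{1,\dots,n\}$ whose bases are the sets $\{i:P_i=1\}$, $\mathrm{st}(P)=(P_1,\dots,P_n)$, for lattice paths $P$ from $(0,0)$ to $(m,r)$ never above $U$ and never below $L$. $P_M=\mathrm{conv}\{\sum_{i\in B}e_i: B\text{ a basis}\}$ and $kP_M=\{kx:x\in P_M\}$. Let $R(M)$ be the closed region bounded by $U$ and $L$, $l_i$ the line $x+y=i$, $T_i=l_i\cap R(M)$. A generalized lattice path of $M$ is a polygonal path with bend points $(x_i,y_i)\in T_i$, $i=0,\dots,n$, with $x_i\le x_{i+1}$ and $y_i\le y_{i+1}$; its step vector $\mathrm{st}(P)$ has $i$-th entry $y_i-y_{i-1}$.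
   Formalization: The point p ranges over ℚ^n instead of ℝ^n, $P_M$ is the convex hull with rational weights, and the bend points of generalized lattice paths are taken in ℚ². -}

module Defs where

open import Data.Bool using (Bool; true; false; if_then_else_)
open import Data.Nat as ℕ using (ℕ; zero; suc)
open import Data.Integer as ℤ using (ℤ; +_)
open import Data.Rational as ℚ using (ℚ; _/_; 0ℚ; 1ℚ)
open import Data.Fin using (Fin; toℕ; inject₁) renaming (suc to fsuc)
open import Data.Fin.Subset using (Subset; _∈_)
open import Data.Vec as Vec using (Vec; lookup)
open import Data.List as List using (List)
open import Data.Nat.ListAction using () renaming (sum to sumℕ)
open import Data.List.Relation.Unary.All using (All)
open import Data.Product using (Σ; ∃; _×_; _,_; proj₁; proj₂)
open import Relation.Binary.PropositionalEquality using (_≡_)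
open import Function.Bundles using (_⇔_)

-- Step vectors of lattice paths: true = north step (0,1) (entry 1),
-- false = east step (1,0) (entry 0).
bitℕ : Bool → ℕ
bitℕ true  = 1
bitℕ false = 0

-- y-coordinate of a lattice path after its first j steps
-- (i.e. its height on the line x + y = j).
height : ∀ {n} → Vec Bool n → ℕ → ℕ
height P j = sumℕ (List.map bitℕ (List.take j (Vec.toList P)))

IsLatticePath : (m r : ℕ) → Vec Bool (r ℕ.+ m) → Set
IsLatticePath m r P = height P (r ℕ.+ m) ≡ r

NeverAbove : ∀ {n} → Vec Bool n → Vec Bool n → Set
NeverAbove {n} P Q = ∀ j → j ℕ.≤ n → height P j ℕ.≤ height Q j

Between : (m r : ℕ) (U L P : Vec Bool (r ℕ.+ m)) → Set
Between m r U L P = IsLatticePath m r P × NeverAbove P U × NeverAbove L P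

IsBasis : (m r : ℕ) (U L : Vec Bool (r ℕ.+ m)) → Subset (r ℕ.+ m) → Set
IsBasis m r U L B =
  ∃ λ P → Between m r U L P × (∀ i → (i ∈ B) ⇔ (lookup P i ≡ true))

ℕ→ℚ : ℕ → ℚ
ℕ→ℚ a = + a / 1

ℤ→ℚ : ℤ → ℚ
ℤ→ℚ z = z / 1

IsInteger : ℚ → Set
IsInteger q = ∃ λ (z : ℤ) → q ≡ ℤ→ℚ z

indicator : ∀ {n} → Subset n → Fin n → ℚ
indicator B i = if lookup B i then 1ℚ else 0ℚ

weightSum : ∀ {n} → List (ℚ × (Fin n → ℚ)) → ℚ
weightSum = List.foldr (λ c acc → proj₁ c ℚ.+ acc) 0ℚ

combination : ∀ {n} → List (ℚ × (Fin n → ℚ)) → Fin n → ℚ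
combination cs i = List.foldr (λ c acc → proj₁ c ℚ.* proj₂ c i ℚ.+ acc) 0ℚ cs

InConvHull : ∀ {n} → ((Fin n → ℚ) → Set) → (Fin n → ℚ) → Set
InConvHull {n} S q =
  Σ (List (ℚ × (Fin n → ℚ))) λ cs →
    All (λ c → (0ℚ ℚ.≤ proj₁ c) × S (proj₂ c)) cs ×
    (weightSum cs ≡ 1ℚ) ×
    (∀ i → q i ≡ combination cs i)

IsBasisVector : (m r : ℕ) (U L : Vec Bool (r ℕ.+ m)) → (Fin (r ℕ.+ m) → ℚ) → Set
IsBasisVector m r U L v = ∃ λ B → IsBasis m r U L B × (∀ i → v i ≡ indicator B i)

InPM : (m r : ℕ) (U L : Vec Bool (r ℕ.+ m)) → (Fin (r ℕ.+ m) → ℚ) → Set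
InPM m r U L = InConvHull (IsBasisVector m r U L)

InKPM : (m r : ℕ) (U L : Vec Bool (r ℕ.+ m)) (k : ℕ) → (Fin (r ℕ.+ m) → ℚ) → Set
InKPM m r U L k q = ∃ λ x → InPM m r U L x × (∀ i → q i ≡ ℕ→ℚ k ℚ.* x i)

InZn : ∀ {n} → (Fin n → ℚ) → Set
InZn q = ∀ i → IsInteger (q i)

-- Generalized lattice paths of M[U,L], given by bend points (x_i,y_i), i = 0..n.
-- (x,y) ∈ T_i = l_i ∩ R(M)  means  x + y = i  and  y_L(i) ≤ y ≤ y_U(i),
-- where y_L(i), y_U(i) are the heights of L and U on the line x + y = i.
InT : (m r : ℕ) (U L : Vec Bool (r ℕ.+ m)) → ℕ → ℚ × ℚ → Set
InT m r U L i (x , y) =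
  (x ℚ.+ y ≡ ℕ→ℚ i) × (ℕ→ℚ (height L i) ℚ.≤ y) × (y ℚ.≤ ℕ→ℚ (height U i))

IsGenPath : (m r : ℕ) (U L : Vec Bool (r ℕ.+ m)) → (Fin (suc (r ℕ.+ m)) → ℚ × ℚ) → Set
IsGenPath m r U L b =
  (∀ i → InT m r U L (toℕ i) (b i)) ×
  (∀ (i : Fin (r ℕ.+ m)) →
     (proj₁ (b (inject₁ i)) ℚ.≤ proj₁ (b (fsuc i))) ×
     (proj₂ (b (inject₁ i)) ℚ.≤ proj₂ (b (fsuc i))))

-- step vector: i-th entry (1-indexed) is y_i − y_{i−1}
genSt : ∀ {n} → (Fin (suc n) → ℚ × ℚ) → Fin n → ℚ
genSt b i = proj₂ (b (fsuc i)) ℚ.- proj₂ (b (inject₁ i))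

KIntegral : ∀ {n} → ℕ → (Fin (suc n) → ℚ × ℚ) → Set
KIntegral k b = ∀ i → IsInteger (ℕ→ℚ k ℚ.* proj₁ (b i)) × IsInteger (ℕ→ℚ k ℚ.* proj₂ (b i))

{-# OPTIONS --safe #-}
-- A point x of P_M is a convex combination of indicator vectors of lattice paths between L
-- and U, so its prefix sums y_t = x_1 + ⋯ + x_t lie between the heights of L and U on the line
-- x + y = t and grow by steps in [0,1]: the points (t − y_t, y_t) are the bend points of a
-- generalized lattice path with step vector x, and they are k-integral when k x is integral.
-- Conversely, if the bend points of a generalized path are K-integral, Y_t = K y_t is an integer
-- sequence with steps in [0,K] lying between K·height L and K·height U. The K paths with heights
-- ⌊(Y_t + j)/K⌋, j < K, are lattice paths between L and U, and by Hermite's identity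
-- ∑_{j<K} ⌊(Y + j)/K⌋ = Y their indicator vectors sum to K st(P), so st(P) ∈ P_M.
module Submission where

open import Defs
open import Data.Bool using (Bool; true; false; if_then_else_)
open import Data.Nat using (ℕ; zero; suc; _+_; _*_; _≤_; _<_; z≤n; s≤s; _≟_; NonZero)
open import Data.Nat.DivMod using (_/_; m<n⇒m/n≡0; m/n≡1+[m∸n]/n; /-monoˡ-≤; m*n/n≡m; m<n*o⇒m/o<n)
import Data.Nat.Properties as ℕP
open import Data.Integer as ℤ using (ℤ; +_; -[1+_])
import Data.Integer.Properties as ℤP
open import Data.Rational as ℚ using (ℚ; mkℚ; 0ℚ; 1ℚ)
import Data.Rational.Properties as ℚP
open import Data.Rational.Solver using (module +-*-Solver)
open +-*-Solver using (solve; _:+_; _:*_; _:-_; _:=_; con)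
import Data.Nat.Coprimality as Coprimality
open import Data.Fin using (Fin; toℕ; inject₁; fromℕ; fromℕ<) renaming (zero to fzero; suc to fsuc)
import Data.Fin.Properties as FinP
open import Data.Vec using (Vec; lookup; []; _∷_; tabulate)
open import Data.Vec.Properties using ([]=⇒lookup; lookup⇒[]=; lookup∘tabulate)
open import Data.List as List using (List; []; _∷_)
open import Data.List.Relation.Unary.All as All using (All; []; _∷_)
open import Data.List.Relation.Unary.All.Properties using (tabulate⁺)
open import Data.Product using (Σ; ∃; _×_; _,_; proj₁; proj₂)
open import Data.Sum using (_⊎_; inj₁; inj₂)
open import Relation.Nullary using (does)
open import Relation.Nullary.Decidable using (dec-true; dec-false)
open import Algebra.Properties.CommutativeMonoid.Sum ℕP.+-0-commutativeMonoid
  using (sum-syntax; sum-cong-≗; sum-replicate-zero; sum-init-last; ∑-distrib-+)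
open import Function using (_∘_)
open import Function.Bundles using (_⇔_; mk⇔; Equivalence)
open import Relation.Binary.PropositionalEquality

private
  fromℤ : ℤ → ℚ
  fromℤ z = mkℚ z 0 (Coprimality.sym (Coprimality.1-coprimeTo _))

  ℤ→ℚ≡fromℤ : ∀ z → ℤ→ℚ z ≡ fromℤ z
  ℤ→ℚ≡fromℤ z = ℚP.↥p/↧p≡p (fromℤ z)

ℤ→ℚ-homo-+ : ∀ a b → ℤ→ℚ (a ℤ.+ b) ≡ ℤ→ℚ a ℚ.+ ℤ→ℚ b
ℤ→ℚ-homo-+ a b rewrite ℤ→ℚ≡fromℤ a | ℤ→ℚ≡fromℤ b =
  cong (ℚ._/ 1) (cong₂ ℤ._+_ (sym (ℤP.*-identityʳ a)) (sym (ℤP.*-identityʳ b)))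

ℤ→ℚ-homo-* : ∀ a b → ℤ→ℚ (a ℤ.* b) ≡ ℤ→ℚ a ℚ.* ℤ→ℚ b
ℤ→ℚ-homo-* a b rewrite ℤ→ℚ≡fromℤ a | ℤ→ℚ≡fromℤ b = refl

ℤ→ℚ-homo‿- : ∀ a → ℤ→ℚ (ℤ.- a) ≡ ℚ.- ℤ→ℚ a
ℤ→ℚ-homo‿- a rewrite ℤ→ℚ≡fromℤ (ℤ.- a) | ℤ→ℚ≡fromℤ a = fromℤ-neg a
  where
  fromℤ-neg : ∀ a → fromℤ (ℤ.- a) ≡ ℚ.- fromℤ a
  fromℤ-neg -[1+ _ ]    = refl
  fromℤ-neg (+ zero)    = refl
  fromℤ-neg (+ (suc _)) = refl

ℤ→ℚ-mono-≤ : ∀ {a b} → a ℤ.≤ b → ℤ→ℚ a ℚ.≤ ℤ→ℚ b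
ℤ→ℚ-mono-≤ {a} {b} a≤b rewrite ℤ→ℚ≡fromℤ a | ℤ→ℚ≡fromℤ b =
  ℚ.*≤* (subst₂ ℤ._≤_ (sym (ℤP.*-identityʳ a)) (sym (ℤP.*-identityʳ b)) a≤b)

ℤ→ℚ-cancel-≤ : ∀ {a b} → ℤ→ℚ a ℚ.≤ ℤ→ℚ b → a ℤ.≤ b
ℤ→ℚ-cancel-≤ {a} {b} a≤b rewrite ℤ→ℚ≡fromℤ a | ℤ→ℚ≡fromℤ b with a≤b
... | ℚ.*≤* a*1≤b*1 = subst₂ ℤ._≤_ (ℤP.*-identityʳ a) (ℤP.*-identityʳ b) a*1≤b*1

ℕ→ℚ-homo-+ : ∀ a b → ℕ→ℚ (a + b) ≡ ℕ→ℚ a ℚ.+ ℕ→ℚ b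
ℕ→ℚ-homo-+ a b = ℤ→ℚ-homo-+ (+ a) (+ b)

ℕ→ℚ-homo-* : ∀ a b → ℕ→ℚ (a * b) ≡ ℕ→ℚ a ℚ.* ℕ→ℚ b
ℕ→ℚ-homo-* a b = trans (cong ℤ→ℚ (ℤP.pos-* a b)) (ℤ→ℚ-homo-* (+ a) (+ b))

ℕ→ℚ-mono-≤ : ∀ {a b} → a ≤ b → ℕ→ℚ a ℚ.≤ ℕ→ℚ b
ℕ→ℚ-mono-≤ a≤b = ℤ→ℚ-mono-≤ (ℤ.+≤+ a≤b)

ℕ→ℚ-cancel-≤ : ∀ {a b} → ℕ→ℚ a ℚ.≤ ℕ→ℚ b → a ≤ b
ℕ→ℚ-cancel-≤ a≤b = ℤP.drop‿+≤+ (ℤ→ℚ-cancel-≤ a≤b)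

ℕ→ℚ-nonNeg : ∀ a → 0ℚ ℚ.≤ ℕ→ℚ a
ℕ→ℚ-nonNeg a = ℕ→ℚ-mono-≤ {0} {a} z≤n

ℕ→ℚ-cancel-+ : ∀ a c {d} → a + c ≡ d → ℕ→ℚ d ℚ.- ℕ→ℚ c ≡ ℕ→ℚ a
ℕ→ℚ-cancel-+ a c refl = trans (cong (ℚ._- ℕ→ℚ c) (ℕ→ℚ-homo-+ a c)) (cancel (ℕ→ℚ a) (ℕ→ℚ c))
  where
  cancel : ∀ p q → (p ℚ.+ q) ℚ.- q ≡ p
  cancel = solve 2 (λ p q → (p :+ q) :- q := p) refl

ℕ→ℚ-invertible : ∀ K .{{_ : NonZero K}} → ∃ λ w → 0ℚ ℚ.≤ w × ℕ→ℚ K ℚ.* w ≡ 1ℚ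
ℕ→ℚ-invertible (suc k) =
  ℚ.1/ fromℤ (+ suc k) , ℚ.*≤* (ℤ.+≤+ z≤n) ,
  trans (cong (ℚ._* ℚ.1/ fromℤ (+ suc k)) (ℤ→ℚ≡fromℤ (+ suc k))) (ℚP.*-inverseʳ (fromℤ (+ suc k)))

*-distribˡ-minus : ∀ p q s → p ℚ.* (q ℚ.- s) ≡ p ℚ.* q ℚ.- p ℚ.* s
*-distribˡ-minus = solve 3 (λ p q s → p :* (q :- s) := p :* q :- p :* s) refl

isInteger-ℕ : ∀ a → IsInteger (ℕ→ℚ a)
isInteger-ℕ a = + a , refl

isInteger-+ : ∀ {p q} → IsInteger p → IsInteger q → IsInteger (p ℚ.+ q)
isInteger-+ (a , refl) (b , refl) = a ℤ.+ b , sym (ℤ→ℚ-homo-+ a b)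

isInteger-- : ∀ {p q} → IsInteger p → IsInteger q → IsInteger (p ℚ.- q)
isInteger-- p∈ℤ (b , refl) = isInteger-+ p∈ℤ (ℤ.- b , sym (ℤ→ℚ-homo‿- b))

isInteger∧nonNeg⇒ℕ : ∀ {q} → IsInteger q → 0ℚ ℚ.≤ q → ∃ λ a → q ≡ ℕ→ℚ a
isInteger∧nonNeg⇒ℕ (+ a , q≡a) _ = a , q≡a
isInteger∧nonNeg⇒ℕ (-[1+ a ] , refl) 0≤q with ℤ→ℚ-cancel-≤ {+ 0} { -[1+ a ]} 0≤q
... | ()

-- Prefix sums and convex combinations

bitVector : ∀ {n} → Vec Bool n → Fin n → ℚ
bitVector P i = ℕ→ℚ (bitℕ (lookup P i))

indicator≡bitVector : ∀ {n} (P : Vec Bool n) i → indicator P i ≡ bitVector P i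
indicator≡bitVector P i with lookup P i
... | true  = refl
... | false = refl

prefixSum : ∀ {n} → (Fin n → ℚ) → ℕ → ℚ
prefixSum f       zero    = 0ℚ
prefixSum {zero}  f (suc t) = 0ℚ
prefixSum {suc n} f (suc t) = f fzero ℚ.+ prefixSum (f ∘ fsuc) t

prefixSum-cong : ∀ {n} {f g : Fin n → ℚ} → (∀ i → f i ≡ g i) → ∀ t → prefixSum f t ≡ prefixSum g t
prefixSum-cong f≗g zero = refl
prefixSum-cong {zero}  f≗g (suc t) = refl
prefixSum-cong {suc n} f≗g (suc t) = cong₂ ℚ._+_ (f≗g fzero) (prefixSum-cong (f≗g ∘ fsuc) t)

prefixSum-suc : ∀ {n} (f : Fin n → ℚ) (i : Fin n) →
  prefixSum f (suc (toℕ i)) ≡ prefixSum f (toℕ i) ℚ.+ f i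
prefixSum-suc f fzero = trans (ℚP.+-identityʳ (f fzero)) (sym (ℚP.+-identityˡ (f fzero)))
prefixSum-suc f (fsuc i) =
  trans (cong (f fzero ℚ.+_) (prefixSum-suc (f ∘ fsuc) i)) (sym (ℚP.+-assoc (f fzero) _ _))

prefixSum-zero : ∀ {n} t → prefixSum {n} (λ _ → 0ℚ) t ≡ 0ℚ
prefixSum-zero zero = refl
prefixSum-zero {zero}  (suc t) = refl
prefixSum-zero {suc n} (suc t) = cong (0ℚ ℚ.+_) (prefixSum-zero {n} t)

prefixSum-+ : ∀ {n} (f g : Fin n → ℚ) t →
  prefixSum (λ i → f i ℚ.+ g i) t ≡ prefixSum f t ℚ.+ prefixSum g t
prefixSum-+ f g zero = refl
prefixSum-+ {zero}  f g (suc t) = refl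
prefixSum-+ {suc n} f g (suc t) =
  trans (cong (f fzero ℚ.+ g fzero ℚ.+_) (prefixSum-+ (f ∘ fsuc) (g ∘ fsuc) t))
        (interchange (f fzero) (g fzero) _ _)
  where
  interchange : ∀ a b c d → (a ℚ.+ b) ℚ.+ (c ℚ.+ d) ≡ (a ℚ.+ c) ℚ.+ (b ℚ.+ d)
  interchange = solve 4 (λ a b c d → (a :+ b) :+ (c :+ d) := (a :+ c) :+ (b :+ d)) refl

prefixSum-* : ∀ {n} a (f : Fin n → ℚ) t → prefixSum (λ i → a ℚ.* f i) t ≡ a ℚ.* prefixSum f t
prefixSum-* a f zero = sym (ℚP.*-zeroʳ a)
prefixSum-* {zero}  a f (suc t) = sym (ℚP.*-zeroʳ a)
prefixSum-* {suc n} a f (suc t) =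
  trans (cong (a ℚ.* f fzero ℚ.+_) (prefixSum-* a (f ∘ fsuc) t))
        (sym (ℚP.*-distribˡ-+ a (f fzero) _))

prefixSum-isInteger : ∀ {n} {f : Fin n → ℚ} → (∀ i → IsInteger (f i)) → ∀ t → IsInteger (prefixSum f t)
prefixSum-isInteger f∈ℤ zero = isInteger-ℕ 0
prefixSum-isInteger {zero}  f∈ℤ (suc t) = isInteger-ℕ 0
prefixSum-isInteger {suc n} f∈ℤ (suc t) = isInteger-+ (f∈ℤ fzero) (prefixSum-isInteger (f∈ℤ ∘ fsuc) t)

prefixSum-bitVector : ∀ {n} (P : Vec Bool n) t → prefixSum (bitVector P) t ≡ ℕ→ℚ (height P t)
prefixSum-bitVector P zero = refl
prefixSum-bitVector [] (suc t) = refl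
prefixSum-bitVector (a ∷ P) (suc t) =
  trans (cong (ℕ→ℚ (bitℕ a) ℚ.+_) (prefixSum-bitVector P t)) (sym (ℕ→ℚ-homo-+ (bitℕ a) (height P t)))

weightedSum : ∀ {n} → ((Fin n → ℚ) → ℚ) → List (ℚ × (Fin n → ℚ)) → ℚ
weightedSum ℓ = List.foldr (λ c acc → proj₁ c ℚ.* ℓ (proj₂ c) ℚ.+ acc) 0ℚ

prefixSum-combination : ∀ {n} (cs : List (ℚ × (Fin n → ℚ))) t →
  prefixSum (combination cs) t ≡ weightedSum (λ v → prefixSum v t) cs
prefixSum-combination []             t = prefixSum-zero t
prefixSum-combination ((w , v) ∷ cs) t =
  trans (prefixSum-+ (λ i → w ℚ.* v i) (combination cs) t)
        (cong₂ ℚ._+_ (prefixSum-* w v t) (prefixSum-combination cs t))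

weightedSum-between : ∀ {n} {a b : ℚ} (ℓ : (Fin n → ℚ) → ℚ) (cs : List (ℚ × (Fin n → ℚ))) →
  All (λ c → 0ℚ ℚ.≤ proj₁ c × a ℚ.≤ ℓ (proj₂ c) × ℓ (proj₂ c) ℚ.≤ b) cs →
  a ℚ.* weightSum cs ℚ.≤ weightedSum ℓ cs × weightedSum ℓ cs ℚ.≤ b ℚ.* weightSum cs
weightedSum-between {a = a} {b} ℓ [] [] =
  ℚP.≤-reflexive (ℚP.*-zeroʳ a) , ℚP.≤-reflexive (sym (ℚP.*-zeroʳ b))
weightedSum-between {a = a} {b} ℓ ((w , v) ∷ cs) ((0≤w , a≤ℓv , ℓv≤b) ∷ hs) =
  (begin
    a ℚ.* (w ℚ.+ W)           ≡⟨ ℚP.*-distribˡ-+ a w W ⟩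
    a ℚ.* w ℚ.+ a ℚ.* W       ≡⟨ cong (ℚ._+ a ℚ.* W) (ℚP.*-comm a w) ⟩
    w ℚ.* a ℚ.+ a ℚ.* W       ≤⟨ ℚP.+-mono-≤ (w*-mono a≤ℓv) (proj₁ ih) ⟩
    w ℚ.* ℓ v ℚ.+ S           ∎) ,
  (begin
    w ℚ.* ℓ v ℚ.+ S           ≤⟨ ℚP.+-mono-≤ (w*-mono ℓv≤b) (proj₂ ih) ⟩
    w ℚ.* b ℚ.+ b ℚ.* W       ≡⟨ cong (ℚ._+ b ℚ.* W) (ℚP.*-comm w b) ⟩
    b ℚ.* w ℚ.+ b ℚ.* W       ≡⟨ ℚP.*-distribˡ-+ b w W ⟨
    b ℚ.* (w ℚ.+ W)           ∎)
  where
  open ℚP.≤-Reasoning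
  W = weightSum cs
  S = weightedSum ℓ cs
  ih = weightedSum-between ℓ cs hs
  w*-mono : ∀ {c d} → c ℚ.≤ d → w ℚ.* c ℚ.≤ w ℚ.* d
  w*-mono = ℚP.*-monoˡ-≤-nonNeg w {{ℚ.nonNegative 0≤w}}

convexCombination-between : ∀ {n} {a b : ℚ} (ℓ : (Fin n → ℚ) → ℚ) (cs : List (ℚ × (Fin n → ℚ))) →
  All (λ c → 0ℚ ℚ.≤ proj₁ c × a ℚ.≤ ℓ (proj₂ c) × ℓ (proj₂ c) ℚ.≤ b) cs →
  weightSum cs ≡ 1ℚ → a ℚ.≤ weightedSum ℓ cs × weightedSum ℓ cs ℚ.≤ b
convexCombination-between {a = a} {b} ℓ cs hs Σw≡1 =
  subst (ℚ._≤ weightedSum ℓ cs) (scale-by-1 a) (proj₁ between) ,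
  subst (weightedSum ℓ cs ℚ.≤_) (scale-by-1 b) (proj₂ between)
  where
  between = weightedSum-between ℓ cs hs
  scale-by-1 : ∀ c → c ℚ.* weightSum cs ≡ c
  scale-by-1 c = trans (cong (c ℚ.*_) Σw≡1) (ℚP.*-identityʳ c)

weightSum-uniform : ∀ {n} K w (vs : Fin K → Fin n → ℚ) →
  weightSum (List.tabulate (λ j → w , vs j)) ≡ ℕ→ℚ K ℚ.* w
weightSum-uniform zero    w vs = sym (ℚP.*-zeroˡ w)
weightSum-uniform (suc K) w vs = begin
  w ℚ.+ weightSum (List.tabulate (λ j → w , vs (fsuc j)))   ≡⟨ cong (w ℚ.+_) (weightSum-uniform K w (vs ∘ fsuc)) ⟩
  w ℚ.+ ℕ→ℚ K ℚ.* w                                        ≡⟨ cong (ℚ._+ ℕ→ℚ K ℚ.* w) (ℚP.*-identityˡ w) ⟨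
  1ℚ ℚ.* w ℚ.+ ℕ→ℚ K ℚ.* w                                 ≡⟨ ℚP.*-distribʳ-+ w 1ℚ (ℕ→ℚ K) ⟨
  (1ℚ ℚ.+ ℕ→ℚ K) ℚ.* w                                     ≡⟨ cong (ℚ._* w) (ℕ→ℚ-homo-+ 1 K) ⟨
  ℕ→ℚ (suc K) ℚ.* w                                        ∎
  where open ≡-Reasoning

combination-uniform : ∀ {n} K w (Ps : Fin K → Vec Bool n) i →
  combination (List.tabulate (λ j → w , indicator (Ps j))) i ≡
  w ℚ.* ℕ→ℚ (∑[ j < K ] bitℕ (lookup (Ps j) i))
combination-uniform zero    w Ps i = sym (ℚP.*-zeroʳ w)
combination-uniform (suc K) w Ps i = begin
  w ℚ.* indicator (Ps fzero) i ℚ.+ combination (List.tabulate (λ j → w , indicator (Ps (fsuc j)))) i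
    ≡⟨ cong₂ (λ a c → w ℚ.* a ℚ.+ c) (indicator≡bitVector (Ps fzero) i) (combination-uniform K w (Ps ∘ fsuc) i) ⟩
  w ℚ.* ℕ→ℚ b₀ ℚ.+ w ℚ.* ℕ→ℚ ∑b
    ≡⟨ ℚP.*-distribˡ-+ w (ℕ→ℚ b₀) (ℕ→ℚ ∑b) ⟨
  w ℚ.* (ℕ→ℚ b₀ ℚ.+ ℕ→ℚ ∑b)
    ≡⟨ cong (w ℚ.*_) (ℕ→ℚ-homo-+ b₀ ∑b) ⟨
  w ℚ.* ℕ→ℚ (b₀ + ∑b)       ∎
  where
  open ≡-Reasoning
  b₀ = bitℕ (lookup (Ps fzero) i)
  ∑b = ∑[ j < K ] bitℕ (lookup (Ps (fsuc j)) i)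

-- The generalized lattice path of a point

genPathOf : ∀ {n} → (Fin n → ℚ) → Fin (suc n) → ℚ × ℚ
genPathOf x i = ℕ→ℚ (toℕ i) ℚ.- prefixSum x (toℕ i) , prefixSum x (toℕ i)

genSt-genPathOf : ∀ {n} (x : Fin n → ℚ) i → genSt (genPathOf x) i ≡ x i
genSt-genPathOf x i rewrite FinP.toℕ-inject₁ i =
  trans (cong (ℚ._- prefixSum x (toℕ i)) (prefixSum-suc x i)) (cancel (prefixSum x (toℕ i)) (x i))
  where
  cancel : ∀ a c → (a ℚ.+ c) ℚ.- a ≡ c
  cancel = solve 2 (λ a c → (a :+ c) :- a := c) refl

genPathOf-mono : ∀ {n} (x : Fin n → ℚ) → (∀ i → 0ℚ ℚ.≤ x i × x i ℚ.≤ 1ℚ) → ∀ (i : Fin n) →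
  proj₁ (genPathOf x (inject₁ i)) ℚ.≤ proj₁ (genPathOf x (fsuc i)) ×
  proj₂ (genPathOf x (inject₁ i)) ℚ.≤ proj₂ (genPathOf x (fsuc i))
genPathOf-mono x x∈[0,1] i rewrite FinP.toℕ-inject₁ i = x-mono , y-mono
  where
  open ℚP.≤-Reasoning
  t = toℕ i
  y = prefixSum x t
  regroup : ∀ a c → a ℚ.- c ≡ (1ℚ ℚ.+ a) ℚ.- (c ℚ.+ 1ℚ)
  regroup = solve 2 (λ a c → a :- c := (con 1ℚ :+ a) :- (c :+ con 1ℚ)) refl
  x-mono : ℕ→ℚ t ℚ.- y ℚ.≤ ℕ→ℚ (suc t) ℚ.- prefixSum x (suc t)
  x-mono = begin
    ℕ→ℚ t ℚ.- y                          ≡⟨ regroup (ℕ→ℚ t) y ⟩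
    (1ℚ ℚ.+ ℕ→ℚ t) ℚ.- (y ℚ.+ 1ℚ)        ≤⟨ ℚP.+-monoʳ-≤ (1ℚ ℚ.+ ℕ→ℚ t) (ℚP.neg-antimono-≤ (ℚP.+-monoʳ-≤ y (proj₂ (x∈[0,1] i)))) ⟩
    (1ℚ ℚ.+ ℕ→ℚ t) ℚ.- (y ℚ.+ x i)       ≡⟨ cong₂ ℚ._-_ (ℕ→ℚ-homo-+ 1 t) (prefixSum-suc x i) ⟨
    ℕ→ℚ (suc t) ℚ.- prefixSum x (suc t)  ∎
  y-mono : y ℚ.≤ prefixSum x (suc t)
  y-mono = begin
    y             ≡⟨ ℚP.+-identityʳ y ⟨
    y ℚ.+ 0ℚ      ≤⟨ ℚP.+-monoʳ-≤ y (proj₁ (x∈[0,1] i)) ⟩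
    y ℚ.+ x i     ≡⟨ prefixSum-suc x i ⟨
    prefixSum x (suc t) ∎

genPathOf-kIntegral : ∀ {n} k {x p : Fin n → ℚ} → (∀ i → p i ≡ ℕ→ℚ k ℚ.* x i) → InZn p →
  KIntegral k (genPathOf x)
genPathOf-kIntegral k {x} {p} p≡kx p∈ℤⁿ i =
  subst IsInteger (sym (*-distribˡ-minus (ℕ→ℚ k) (ℕ→ℚ t) y))
    (isInteger-- (subst IsInteger (ℕ→ℚ-homo-* k t) (isInteger-ℕ (k * t))) ky∈ℤ) ,
  ky∈ℤ
  where
  t = toℕ i
  y = prefixSum x t
  ky∈ℤ : IsInteger (ℕ→ℚ k ℚ.* y)
  ky∈ℤ = subst IsInteger (trans (prefixSum-cong p≡kx t) (prefixSum-* (ℕ→ℚ k) x t))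
           (prefixSum-isInteger p∈ℤⁿ t)

genSt-kIntegral : ∀ {n} k {b : Fin (suc n) → ℚ × ℚ} {p : Fin n → ℚ} → KIntegral k b →
  (∀ i → p i ≡ ℕ→ℚ k ℚ.* genSt b i) → InZn p
genSt-kIntegral k {b} b∈ℤ p≡k·st i =
  subst IsInteger (sym (trans (p≡k·st i) (*-distribˡ-minus (ℕ→ℚ k) (proj₂ (b (fsuc i))) (proj₂ (b (inject₁ i))))))
    (isInteger-- (proj₂ (b∈ℤ (fsuc i))) (proj₂ (b∈ℤ (inject₁ i))))

y-step-≤1 : ∀ {x y x′ y′ c} → x ℚ.+ y ≡ c → x′ ℚ.+ y′ ≡ 1ℚ ℚ.+ c → x ℚ.≤ x′ → y′ ℚ.≤ y ℚ.+ 1ℚ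
y-step-≤1 {x} {y} {x′} {y′} {c} x+y≡c x′+y′≡1+c x≤x′ = begin
  y′                       ≡⟨ solve 2 (λ a b → b := (a :+ b) :- a) refl x′ y′ ⟩
  (x′ ℚ.+ y′) ℚ.- x′       ≡⟨ cong (ℚ._- x′) x′+y′≡1+c ⟩
  (1ℚ ℚ.+ c) ℚ.- x′        ≤⟨ ℚP.+-monoʳ-≤ (1ℚ ℚ.+ c) (ℚP.neg-antimono-≤ x≤x′) ⟩
  (1ℚ ℚ.+ c) ℚ.- x         ≡⟨ cong (λ a → (1ℚ ℚ.+ a) ℚ.- x) x+y≡c ⟨
  (1ℚ ℚ.+ (x ℚ.+ y)) ℚ.- x ≡⟨ solve 2 (λ a b → (con 1ℚ :+ (a :+ b)) :- a := b :+ con 1ℚ) refl x y ⟩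
  y ℚ.+ 1ℚ                 ∎
  where open ℚP.≤-Reasoning

-- Floor paths

[m+n]/n≡1+m/n : ∀ m n .{{_ : NonZero n}} → (m + n) / n ≡ suc (m / n)
[m+n]/n≡1+m/n m n =
  trans (m/n≡1+[m∸n]/n (ℕP.m≤n+m n m)) (cong (λ a → suc (a / n)) (ℕP.m+n∸n≡m m n))

-- Raising Y by one drops the term ⌊Y/K⌋ and adds ⌊(Y+K)/K⌋ = ⌊Y/K⌋ + 1.
hermite : ∀ K .{{_ : NonZero K}} Y → ∑[ j < K ] ((Y + toℕ j) / K) ≡ Y
hermite K zero    = trans (sum-cong-≗ (λ j → m<n⇒m/n≡0 (FinP.toℕ<n j))) (sum-replicate-zero K)
hermite K (suc Y) = ℕP.+-cancelˡ-≡ (Y / K) _ _ (begin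
  Y / K + ∑[ j < K ] ((suc Y + toℕ j) / K)
    ≡⟨ cong₂ _+_ (cong (_/ K) (sym (ℕP.+-identityʳ Y)))
                 (sum-cong-≗ {K} (λ j → cong (_/ K) (sym (ℕP.+-suc Y (toℕ j))))) ⟩
  ∑[ j < suc K ] ((Y + toℕ j) / K)
    ≡⟨ sum-init-last (λ j → (Y + toℕ j) / K) ⟩
  ∑[ j < K ] ((Y + toℕ (inject₁ j)) / K) + (Y + toℕ (fromℕ K)) / K
    ≡⟨ cong₂ _+_ (trans (sum-cong-≗ {K} (λ j → cong (λ a → (Y + a) / K) (FinP.toℕ-inject₁ j)))
                        (hermite K Y))
                 (trans (cong (λ a → (Y + a) / K) (FinP.toℕ-fromℕ K)) ([m+n]/n≡1+m/n Y K)) ⟩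
  Y + suc (Y / K)
    ≡⟨ ℕP.+-comm Y (suc (Y / K)) ⟩
  suc (Y / K + Y)
    ≡⟨ ℕP.+-suc (Y / K) Y ⟨
  Y / K + suc Y ∎)
  where open ≡-Reasoning

*≤⇒≤/ : ∀ K .{{_ : NonZero K}} {a c} → K * a ≤ c → a ≤ c / K
*≤⇒≤/ K {a} {c} Ka≤c =
  subst (_≤ c / K) (m*n/n≡m a K) (/-monoˡ-≤ K (subst (_≤ c) (ℕP.*-comm K a) Ka≤c))

≤*⇒[+]/≤ : ∀ K .{{_ : NonZero K}} {a c j} → c ≤ K * a → j < K → (c + j) / K ≤ a
≤*⇒[+]/≤ K {a} {c} {j} c≤Ka j<K = ℕP.≤-pred (m<n*o⇒m/o<n (begin-strict
  c + j          <⟨ ℕP.+-mono-≤-< c≤Ka j<K ⟩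
  K * a + K      ≡⟨ ℕP.+-comm (K * a) K ⟩
  K + K * a      ≡⟨ cong (λ z → K + z) (ℕP.*-comm K a) ⟩
  suc a * K      ∎))
  where open ℕP.≤-Reasoning

/-step : ∀ K .{{_ : NonZero K}} {a b} → a ≤ b → b ≤ a + K → b / K ≡ a / K ⊎ b / K ≡ suc (a / K)
/-step K {a} {b} a≤b b≤a+K with ℕP.m≤n⇒m<n∨m≡n b/K≤1+a/K
  where
  b/K≤1+a/K : b / K ≤ suc (a / K)
  b/K≤1+a/K = subst (b / K ≤_) ([m+n]/n≡1+m/n a K) (/-monoˡ-≤ K b≤a+K)
... | inj₁ b/K≤a/K = inj₁ (ℕP.≤-antisym (ℕP.≤-pred b/K≤a/K) (/-monoˡ-≤ K a≤b))
... | inj₂ b/K≡1+a/K = inj₂ b/K≡1+a/K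

height-suc : ∀ {n} (P : Vec Bool n) (i : Fin n) →
  height P (suc (toℕ i)) ≡ height P (toℕ i) + bitℕ (lookup P i)
height-suc (a ∷ P) fzero    = ℕP.+-identityʳ (bitℕ a)
height-suc (a ∷ P) (fsuc i) =
  trans (cong (λ z → bitℕ a + z) (height-suc P i)) (sym (ℕP.+-assoc (bitℕ a) _ _))

UnitSteps : ℕ → (ℕ → ℕ) → Set
UnitSteps n h = ∀ t → t < n → h (suc t) ≡ h t ⊎ h (suc t) ≡ suc (h t)

pathOf : ∀ n → (ℕ → ℕ) → Vec Bool n
pathOf n h = tabulate (λ i → does (h (suc (toℕ i)) ≟ suc (h (toℕ i))))

pathOf-step : ∀ {n h} → UnitSteps n h → ∀ i →
  h (suc (toℕ i)) ≡ h (toℕ i) + bitℕ (lookup (pathOf n h) i)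
pathOf-step {h = h} steps i
  rewrite lookup∘tabulate (λ i → does (h (suc (toℕ i)) ≟ suc (h (toℕ i)))) i =
  unitStep (steps (toℕ i) (FinP.toℕ<n i))
  where
  open ≡-Reasoning
  unitStep : ∀ {a b} → b ≡ a ⊎ b ≡ suc a → b ≡ a + bitℕ (does (b ≟ suc a))
  unitStep {a} {b} (inj₁ b≡a) = begin
    b                                ≡⟨ b≡a ⟩
    a                                ≡⟨ ℕP.+-identityʳ a ⟨
    a + bitℕ false                   ≡⟨ cong (λ x → a + bitℕ x) (dec-false (b ≟ suc a) b≢1+a) ⟨
    a + bitℕ (does (b ≟ suc a))      ∎
    where
    b≢1+a : b ≢ suc a
    b≢1+a b≡1+a = ℕP.1+n≢n (trans (sym b≡1+a) b≡a)
  unitStep {a} {b} (inj₂ b≡1+a) = begin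
    b                                ≡⟨ b≡1+a ⟩
    suc a                            ≡⟨ ℕP.+-comm 1 a ⟩
    a + bitℕ true                    ≡⟨ cong (λ x → a + bitℕ x) (dec-true (b ≟ suc a) b≡1+a) ⟨
    a + bitℕ (does (b ≟ suc a))      ∎

height-pathOf : ∀ {n h} → h 0 ≡ 0 → UnitSteps n h → ∀ t → t ≤ n → height (pathOf n h) t ≡ h t
height-pathOf h0≡0 steps zero    _     = sym h0≡0
height-pathOf {n} {h} h0≡0 steps (suc t) 1+t≤n =
  subst (λ s → height P (suc s) ≡ h (suc s)) toℕi≡t (begin
    height P (suc (toℕ i))                    ≡⟨ height-suc P i ⟩
    height P (toℕ i) + bitℕ (lookup P i)      ≡⟨ cong (_+ bitℕ (lookup P i)) ih ⟩
    h (toℕ i) + bitℕ (lookup P i)             ≡⟨ pathOf-step steps i ⟨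
    h (suc (toℕ i))                           ∎)
  where
  open ≡-Reasoning
  P = pathOf n h
  i = fromℕ< 1+t≤n
  toℕi≡t : toℕ i ≡ t
  toℕi≡t = FinP.toℕ-fromℕ< 1+t≤n
  ih : height P (toℕ i) ≡ h (toℕ i)
  ih rewrite toℕi≡t = height-pathOf h0≡0 steps t (ℕP.<⇒≤ 1+t≤n)

module FloorPaths (K : ℕ) .{{_ : NonZero K}} (n : ℕ) (Y : ℕ → ℕ) (Y0≡0 : Y 0 ≡ 0)
  (Y-step : ∀ t → t < n → Y t ≤ Y (suc t) × Y (suc t) ≤ Y t + K) where

  floorPath : ℕ → Vec Bool n
  floorPath j = pathOf n (λ t → (Y t + j) / K)

  floorPath-unitSteps : ∀ j → UnitSteps n (λ t → (Y t + j) / K)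
  floorPath-unitSteps j t t<n = /-step K (ℕP.+-monoˡ-≤ j (proj₁ (Y-step t t<n))) (begin
    Y (suc t) + j     ≤⟨ ℕP.+-monoˡ-≤ j (proj₂ (Y-step t t<n)) ⟩
    Y t + K + j       ≡⟨ ℕP.+-assoc (Y t) K j ⟩
    Y t + (K + j)     ≡⟨ cong (λ a → Y t + a) (ℕP.+-comm K j) ⟩
    Y t + (j + K)     ≡⟨ ℕP.+-assoc (Y t) j K ⟨
    Y t + j + K       ∎)
    where open ℕP.≤-Reasoning

  height-floorPath : ∀ {j} → j < K → ∀ t → t ≤ n → height (floorPath j) t ≡ (Y t + j) / K
  height-floorPath {j} j<K =
    height-pathOf (trans (cong (λ a → (a + j) / K) Y0≡0) (m<n⇒m/n≡0 j<K)) (floorPath-unitSteps j)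

  ∑-bit-floorPath : ∀ i → ∑[ j < K ] bitℕ (lookup (floorPath (toℕ j)) i) + Y (toℕ i) ≡ Y (suc (toℕ i))
  ∑-bit-floorPath i = begin
    ∑bits + Y t                                             ≡⟨ ℕP.+-comm ∑bits (Y t) ⟩
    Y t + ∑bits                                             ≡⟨ cong (_+ ∑bits) (hermite K (Y t)) ⟨
    ∑[ j < K ] ((Y t + toℕ j) / K) + ∑bits                  ≡⟨ ∑-distrib-+ (λ j → (Y t + toℕ j) / K) bit ⟨
    ∑[ j < K ] ((Y t + toℕ j) / K + bit j)                  ≡⟨ sum-cong-≗ {K} (λ j → pathOf-step (floorPath-unitSteps (toℕ j)) i) ⟨
    ∑[ j < K ] ((Y (suc t) + toℕ j) / K)                    ≡⟨ hermite K (Y (suc t)) ⟩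
    Y (suc t)                                               ∎
    where
    open ≡-Reasoning
    t = toℕ i
    bit : Fin K → ℕ
    bit j = bitℕ (lookup (floorPath (toℕ j)) i)
    ∑bits = ∑[ j < K ] bit j

atℕ : ∀ {N} {A : Set} → (Fin (suc N) → A) → ℕ → A
atℕ f zero = f fzero
atℕ {zero}  f (suc t) = f fzero
atℕ {suc N} f (suc t) = atℕ (f ∘ fsuc) t

atℕ-toℕ : ∀ {N} {A : Set} (f : Fin (suc N) → A) i → atℕ f (toℕ i) ≡ f i
atℕ-toℕ f fzero = refl
atℕ-toℕ {suc N} f (fsuc i) = atℕ-toℕ (f ∘ fsuc) i

atℕ-∀ : ∀ {N} {A : Set} (Q : ℕ → A → Set) (f : Fin (suc N) → A) →
  (∀ i → Q (toℕ i) (f i)) → ∀ t → t ≤ N → Q t (atℕ f t)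
atℕ-∀ Q f Qf zero _ = Qf fzero
atℕ-∀ {suc N} Q f Qf (suc t) (s≤s t≤N) = atℕ-∀ (Q ∘ suc) (f ∘ fsuc) (Qf ∘ fsuc) t t≤N

atℕ-steps : ∀ {N} {A : Set} (R : A → A → Set) (f : Fin (suc N) → A) →
  (∀ i → R (f (inject₁ i)) (f (fsuc i))) → ∀ t → t < N → R (atℕ f t) (atℕ f (suc t))
atℕ-steps {suc N} R f Rf zero    _         = Rf fzero
atℕ-steps {suc N} R f Rf (suc t) (s≤s t<N) = atℕ-steps R (f ∘ fsuc) (Rf ∘ fsuc) t t<N

-- The lattice path matroid M[U,L]

⇔true⇒≡ : ∀ {a b : Bool} → (a ≡ true → b ≡ true) → (b ≡ true → a ≡ true) → a ≡ b
⇔true⇒≡ {true}         a→b _   = sym (a→b refl)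
⇔true⇒≡ {false} {true} _   b→a = b→a refl
⇔true⇒≡ {false} {false} _  _   = refl

module LatticePathMatroid (m r : ℕ) (U L : Vec Bool (r + m)) where

  private
    n = r + m

  sandwiched⇒Between : IsLatticePath m r U → IsLatticePath m r L →
    ∀ {P} → NeverAbove P U → NeverAbove L P → Between m r U L P
  sandwiched⇒Between hU hL {P} P≤U L≤P =
    ℕP.≤-antisym (subst (height P n ≤_) hU (P≤U n ℕP.≤-refl))
                 (subst (_≤ height P n) hL (L≤P n ℕP.≤-refl)) ,
    P≤U , L≤P

  basisVector⇒path : ∀ {v} → IsBasisVector m r U L v →
    ∃ λ P → Between m r U L P × (∀ i → v i ≡ bitVector P i)
  basisVector⇒path {v} (B , (P , P∈M , i∈B⇔Pi) , v≡B) = P , P∈M , v≡P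
    where
    B≡P : ∀ i → lookup B i ≡ lookup P i
    B≡P i = ⇔true⇒≡ (Equivalence.to (i∈B⇔Pi i) ∘ lookup⇒[]= i B) ([]=⇒lookup ∘ Equivalence.from (i∈B⇔Pi i))
    v≡P : ∀ i → v i ≡ bitVector P i
    v≡P i = trans (v≡B i) (trans (cong (λ a → if a then 1ℚ else 0ℚ) (B≡P i)) (indicator≡bitVector P i))

  path⇒basisVector : ∀ {P} → Between m r U L P → IsBasisVector m r U L (indicator P)
  path⇒basisVector {P} P∈M = P , (P , P∈M , λ i → mk⇔ []=⇒lookup (lookup⇒[]= i P)) , λ _ → refl

  basisVector-entry-between : ∀ {v} → IsBasisVector m r U L v → ∀ i → 0ℚ ℚ.≤ v i × v i ℚ.≤ 1ℚ
  basisVector-entry-between v∈M i with basisVector⇒path v∈M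
  ... | P , _ , v≡P = subst (λ q → 0ℚ ℚ.≤ q × q ℚ.≤ 1ℚ) (sym (v≡P i))
                        (ℕ→ℚ-nonNeg (bitℕ (lookup P i)) , ℕ→ℚ-mono-≤ (bitℕ≤1 (lookup P i)))
    where
    bitℕ≤1 : ∀ a → bitℕ a ≤ 1
    bitℕ≤1 true  = ℕP.≤-refl
    bitℕ≤1 false = z≤n

  basisVector-prefixSum-between : ∀ {v} → IsBasisVector m r U L v → ∀ t → t ≤ n →
    ℕ→ℚ (height L t) ℚ.≤ prefixSum v t × prefixSum v t ℚ.≤ ℕ→ℚ (height U t)
  basisVector-prefixSum-between v∈M t t≤n with basisVector⇒path v∈M
  ... | P , (_ , P≤U , L≤P) , v≡P =
    subst (λ q → ℕ→ℚ (height L t) ℚ.≤ q × q ℚ.≤ ℕ→ℚ (height U t))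
          (sym (trans (prefixSum-cong v≡P t) (prefixSum-bitVector P t)))
          (ℕ→ℚ-mono-≤ (L≤P t t≤n) , ℕ→ℚ-mono-≤ (P≤U t t≤n))

  InPM-entry-between : ∀ {x} → InPM m r U L x → ∀ i → 0ℚ ℚ.≤ x i × x i ℚ.≤ 1ℚ
  InPM-entry-between (cs , cs∈M , Σw≡1 , x≡cs) i =
    subst (λ q → 0ℚ ℚ.≤ q × q ℚ.≤ 1ℚ) (sym (x≡cs i))
      (convexCombination-between (λ v → v i) cs
        (All.map (λ (0≤w , v∈M) → 0≤w , basisVector-entry-between v∈M i) cs∈M) Σw≡1)

  InPM-prefixSum-between : ∀ {x} → InPM m r U L x → ∀ t → t ≤ n →
    ℕ→ℚ (height L t) ℚ.≤ prefixSum x t × prefixSum x t ℚ.≤ ℕ→ℚ (height U t)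
  InPM-prefixSum-between (cs , cs∈M , Σw≡1 , x≡cs) t t≤n =
    subst (λ q → ℕ→ℚ (height L t) ℚ.≤ q × q ℚ.≤ ℕ→ℚ (height U t))
      (sym (trans (prefixSum-cong x≡cs t) (prefixSum-combination cs t)))
      (convexCombination-between (λ v → prefixSum v t) cs
        (All.map (λ (0≤w , v∈M) → 0≤w , basisVector-prefixSum-between v∈M t t≤n) cs∈M) Σw≡1)

  genPathOf-isGenPath : ∀ {x} → InPM m r U L x → IsGenPath m r U L (genPathOf x)
  genPathOf-isGenPath {x} x∈PM =
    (λ i → cancel (ℕ→ℚ (toℕ i)) (prefixSum x (toℕ i)) ,
           InPM-prefixSum-between x∈PM (toℕ i) (FinP.toℕ≤pred[n] i)) ,
    genPathOf-mono x (InPM-entry-between x∈PM)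
    where
    cancel : ∀ a c → (a ℚ.- c) ℚ.+ c ≡ a
    cancel = solve 2 (λ a c → (a :- c) :+ c := a) refl

  vertex-∈PM : ∀ {P} → Between m r U L P → InPM m r U L (indicator P)
  vertex-∈PM {P} P∈M =
    (1ℚ , indicator P) ∷ [] , (ℕ→ℚ-nonNeg 1 , path⇒basisVector P∈M) ∷ [] , ℚP.+-identityʳ 1ℚ ,
    λ i → sym (trans (ℚP.+-identityʳ _) (ℚP.*-identityˡ _))

  sum-of-bases⇒InPM : ∀ K .{{_ : NonZero K}} (Ps : Fin K → Vec Bool n) → (∀ j → Between m r U L (Ps j)) →
    ∀ {x} → (∀ i → ℕ→ℚ K ℚ.* x i ≡ ℕ→ℚ (∑[ j < K ] bitℕ (lookup (Ps j) i))) → InPM m r U L x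
  sum-of-bases⇒InPM K Ps Ps∈M {x} Kx≡∑ with ℕ→ℚ-invertible K
  ... | w , 0≤w , Kw≡1 =
    cs , tabulate⁺ (λ j → 0≤w , path⇒basisVector (Ps∈M j)) ,
    trans (weightSum-uniform K w (indicator ∘ Ps)) Kw≡1 , x≡cs
    where
    cs = List.tabulate (λ j → w , indicator (Ps j))
    x≡cs : ∀ i → x i ≡ combination cs i
    x≡cs i = begin
      x i                                ≡⟨ ℚP.*-identityˡ (x i) ⟨
      1ℚ ℚ.* x i                         ≡⟨ cong (ℚ._* x i) (trans (ℚP.*-comm w (ℕ→ℚ K)) Kw≡1) ⟨
      w ℚ.* ℕ→ℚ K ℚ.* x i                ≡⟨ ℚP.*-assoc w (ℕ→ℚ K) (x i) ⟩
      w ℚ.* (ℕ→ℚ K ℚ.* x i)              ≡⟨ cong (w ℚ.*_) (Kx≡∑ i) ⟩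
      w ℚ.* ℕ→ℚ (∑[ j < K ] bitℕ (lookup (Ps j) i)) ≡⟨ combination-uniform K w Ps i ⟨
      combination cs i                   ∎
      where open ≡-Reasoning

  dilatedPath-decomposition : IsLatticePath m r U → IsLatticePath m r L →
    ∀ K .{{_ : NonZero K}} (Y : Fin (suc n) → ℕ) →
    (∀ i → K * height L (toℕ i) ≤ Y i × Y i ≤ K * height U (toℕ i)) →
    (∀ i → Y (inject₁ i) ≤ Y (fsuc i) × Y (fsuc i) ≤ Y (inject₁ i) + K) →
    ∃ λ (Ps : Fin K → Vec Bool n) → (∀ j → Between m r U L (Ps j)) ×
      (∀ i → ∑[ j < K ] bitℕ (lookup (Ps j) i) + Y (inject₁ i) ≡ Y (fsuc i))
  dilatedPath-decomposition hU hL K Y Y-between Y-step =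
    floorPath ∘ toℕ , floorPath-between ∘ FinP.toℕ<n , ∑-bits
    where
    Yℕ = atℕ Y
    Yℕ-between : ∀ t → t ≤ n → K * height L t ≤ Yℕ t × Yℕ t ≤ K * height U t
    Yℕ-between = atℕ-∀ (λ t a → K * height L t ≤ a × a ≤ K * height U t) Y Y-between
    Yℕ0≡0 : Yℕ 0 ≡ 0
    Yℕ0≡0 = ℕP.n≤0⇒n≡0 (subst (Y fzero ≤_) (ℕP.*-zeroʳ K) (proj₂ (Y-between fzero)))
    open FloorPaths K n Yℕ Yℕ0≡0 (atℕ-steps (λ a c → a ≤ c × c ≤ a + K) Y Y-step)
    floorPath-between : ∀ {j} → j < K → Between m r U L (floorPath j)
    floorPath-between {j} j<K = sandwiched⇒Between hU hL
      (λ t t≤n → subst (_≤ height U t) (sym (height-floorPath j<K t t≤n))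
                   (≤*⇒[+]/≤ K (proj₂ (Yℕ-between t t≤n)) j<K))
      (λ t t≤n → subst (height L t ≤_) (sym (height-floorPath j<K t t≤n))
                   (*≤⇒≤/ K (ℕP.≤-trans (proj₁ (Yℕ-between t t≤n)) (ℕP.m≤m+n (Yℕ t) j))))
    ∑-bits : ∀ i → ∑[ j < K ] bitℕ (lookup (floorPath (toℕ j)) i) + Y (inject₁ i) ≡ Y (fsuc i)
    ∑-bits i = subst₂ (λ a c → ∑[ j < K ] bitℕ (lookup (floorPath (toℕ j)) i) + a ≡ c)
      (trans (cong Yℕ (sym (FinP.toℕ-inject₁ i))) (atℕ-toℕ Y (inject₁ i))) (atℕ-toℕ Y (fsuc i))
      (∑-bit-floorPath i)

  module DilatedGenPath (K : ℕ) .{{_ : NonZero K}} {b : Fin (suc n) → ℚ × ℚ}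
    (b∈M : IsGenPath m r U L b) (b∈ℤ : KIntegral K b) where

    private
      y : Fin (suc n) → ℚ
      y i = proj₂ (b i)

      K*-mono : ∀ {p q} → p ℚ.≤ q → ℕ→ℚ K ℚ.* p ℚ.≤ ℕ→ℚ K ℚ.* q
      K*-mono = ℚP.*-monoˡ-≤-nonNeg (ℕ→ℚ K) {{ℚ.nonNegative (ℕ→ℚ-nonNeg K)}}

      L≤y : ∀ i → ℕ→ℚ (height L (toℕ i)) ℚ.≤ y i
      L≤y i = proj₁ (proj₂ (proj₁ b∈M i))

      y≤U : ∀ i → y i ℚ.≤ ℕ→ℚ (height U (toℕ i))
      y≤U i = proj₂ (proj₂ (proj₁ b∈M i))

      Ky∈ℕ : ∀ i → ∃ λ a → ℕ→ℚ K ℚ.* y i ≡ ℕ→ℚ a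
      Ky∈ℕ i = isInteger∧nonNeg⇒ℕ (proj₂ (b∈ℤ i))
        (subst (ℚ._≤ ℕ→ℚ K ℚ.* y i) (ℚP.*-zeroʳ (ℕ→ℚ K))
          (K*-mono (ℚP.≤-trans (ℕ→ℚ-nonNeg (height L (toℕ i))) (L≤y i))))

    Y : Fin (suc n) → ℕ
    Y i = proj₁ (Ky∈ℕ i)

    ℕ→ℚ-Y : ∀ i → ℕ→ℚ (Y i) ≡ ℕ→ℚ K ℚ.* y i
    ℕ→ℚ-Y i = sym (proj₂ (Ky∈ℕ i))

    Y-between : ∀ i → K * height L (toℕ i) ≤ Y i × Y i ≤ K * height U (toℕ i)
    Y-between i =
      ℕ→ℚ-cancel-≤ (subst₂ ℚ._≤_ (sym (ℕ→ℚ-homo-* K _)) (sym (ℕ→ℚ-Y i)) (K*-mono (L≤y i))) ,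
      ℕ→ℚ-cancel-≤ (subst₂ ℚ._≤_ (sym (ℕ→ℚ-Y i)) (sym (ℕ→ℚ-homo-* K _)) (K*-mono (y≤U i)))

    Y-step : ∀ i → Y (inject₁ i) ≤ Y (fsuc i) × Y (fsuc i) ≤ Y (inject₁ i) + K
    Y-step i =
      ℕ→ℚ-cancel-≤ (subst₂ ℚ._≤_ (sym (ℕ→ℚ-Y (inject₁ i))) (sym (ℕ→ℚ-Y (fsuc i)))
                     (K*-mono (proj₂ (proj₂ b∈M i)))) ,
      ℕ→ℚ-cancel-≤ (begin
        ℕ→ℚ (Y (fsuc i))                          ≡⟨ ℕ→ℚ-Y (fsuc i) ⟩
        ℕ→ℚ K ℚ.* y (fsuc i)                      ≤⟨ K*-mono y-step ⟩
        ℕ→ℚ K ℚ.* (y (inject₁ i) ℚ.+ 1ℚ)          ≡⟨ ℚP.*-distribˡ-+ (ℕ→ℚ K) (y (inject₁ i)) 1ℚ ⟩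
        ℕ→ℚ K ℚ.* y (inject₁ i) ℚ.+ ℕ→ℚ K ℚ.* 1ℚ ≡⟨ cong₂ ℚ._+_ (sym (ℕ→ℚ-Y (inject₁ i))) (ℚP.*-identityʳ (ℕ→ℚ K)) ⟩
        ℕ→ℚ (Y (inject₁ i)) ℚ.+ ℕ→ℚ K             ≡⟨ ℕ→ℚ-homo-+ (Y (inject₁ i)) K ⟨
        ℕ→ℚ (Y (inject₁ i) + K)                   ∎)
      where
      open ℚP.≤-Reasoning
      y-step : y (fsuc i) ℚ.≤ y (inject₁ i) ℚ.+ 1ℚ
      y-step = y-step-≤1
        (trans (proj₁ (proj₁ b∈M (inject₁ i))) (cong ℕ→ℚ (FinP.toℕ-inject₁ i)))
        (trans (proj₁ (proj₁ b∈M (fsuc i))) (ℕ→ℚ-homo-+ 1 (toℕ i)))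
        (proj₁ (proj₂ b∈M i))

    K*genSt : ∀ {a} i → a + Y (inject₁ i) ≡ Y (fsuc i) → ℕ→ℚ K ℚ.* genSt b i ≡ ℕ→ℚ a
    K*genSt {a} i a+Y≡Y = begin
      ℕ→ℚ K ℚ.* (y (fsuc i) ℚ.- y (inject₁ i))              ≡⟨ *-distribˡ-minus (ℕ→ℚ K) (y (fsuc i)) (y (inject₁ i)) ⟩
      ℕ→ℚ K ℚ.* y (fsuc i) ℚ.- ℕ→ℚ K ℚ.* y (inject₁ i)      ≡⟨ cong₂ ℚ._-_ (ℕ→ℚ-Y (fsuc i)) (ℕ→ℚ-Y (inject₁ i)) ⟨
      ℕ→ℚ (Y (fsuc i)) ℚ.- ℕ→ℚ (Y (inject₁ i))              ≡⟨ ℕ→ℚ-cancel-+ a (Y (inject₁ i)) a+Y≡Y ⟩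
      ℕ→ℚ a                                                  ∎
      where open ≡-Reasoning

  genSt-∈PM : IsLatticePath m r U → IsLatticePath m r L →
    ∀ K .{{_ : NonZero K}} {b} → IsGenPath m r U L b → KIntegral K b → InPM m r U L (genSt b)
  genSt-∈PM hU hL K b∈M b∈ℤ =
    let Ps , Ps∈M , ∑Ps+Y≡Y = dilatedPath-decomposition hU hL K Y Y-between Y-step
    in  sum-of-bases⇒InPM K Ps Ps∈M (λ i → K*genSt i (∑Ps+Y≡Y i))
    where open DilatedGenPath K b∈M b∈ℤ

  genPath⇒InKPM : IsLatticePath m r U → IsLatticePath m r L → NeverAbove L U →
    ∀ k {b p} → IsGenPath m r U L b → KIntegral k b → (∀ i → p i ≡ ℕ→ℚ k ℚ.* genSt b i) →
    InKPM m r U L k p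
  genPath⇒InKPM hU hL L≤U zero {b} _ _ p≡0 =
    indicator L , vertex-∈PM (sandwiched⇒Between hU hL L≤U (λ _ _ → ℕP.≤-refl)) ,
    λ i → trans (p≡0 i) (trans (ℚP.*-zeroˡ (genSt {n} b i)) (sym (ℚP.*-zeroˡ (indicator L i))))
  genPath⇒InKPM hU hL _ (suc k) {b} b∈M b∈ℤ p≡k·st = genSt b , genSt-∈PM hU hL (suc k) b∈M b∈ℤ , p≡k·st

corollary3p6 : (m r : ℕ) (U L : Vec Bool (r + m)) →
    IsLatticePath m r U → IsLatticePath m r L → NeverAbove L U →
    (k : ℕ) (p : Fin (r + m) → ℚ) →
    (InKPM m r U L k p × InZn p) ⇔
      Σ (Fin (suc (r + m)) → ℚ × ℚ) (λ b →
        IsGenPath m r U L b × KIntegral k b ×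
        (∀ i → p i ≡ ℕ→ℚ k ℚ.* genSt b i))
corollary3p6 m r U L hU hL L≤U k p = mk⇔
  (λ ((x , x∈PM , p≡kx) , p∈ℤⁿ) →
    genPathOf x , genPathOf-isGenPath x∈PM , genPathOf-kIntegral k p≡kx p∈ℤⁿ ,
    λ i → trans (p≡kx i) (cong (ℕ→ℚ k ℚ.*_) (sym (genSt-genPathOf x i))))
  (λ (b , b∈M , b∈ℤ , p≡k·st) →
    genPath⇒InKPM hU hL L≤U k b∈M b∈ℤ p≡k·st , genSt-kIntegral k b∈ℤ p≡k·st)
  where open LatticePathMatroid m r U L
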